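{- Let $\mathcal{T}=(S,S_0,\varrho,L)$ be a finite transition system and $\varphi=\forall\pi.\exists\pi'.\,\phi$ a HyperLTL formula whose matrix $\phi$ is a safety property, recognized by a deterministic safety automaton $\mathcal{A}^\phi=(Q^\phi,q^\phi_0,\delta^\phi,B^\phi)$ over $\Sigma\times\Sigma$ (first component for $\pi$, second for $\pi'$). Assume $\mathcal{T}\models\varphi$. For $q\in Q^\phi$ and $s\in S$ let $$\mathfrak{P}_{q,s}=\{t\in\Sigma^\omega\mid \exists t'\in\mathit{Traces}(\mathcal{T}_s).\ t\otimes t'\in\mathcal{L}(\mathcal{A}^\phi_q)\},$$ and let $\xi_{q,s}$ be a QPTL formula over trace variable $\pi$ defining $\mathfrak{P}_{q,s}$. Let $\Xi=\{\xi_{q,s}\mid q\in Q^\phi,s\in S\}$ and let $P=\{p_{q,s}\mid q\in Q^\phi,s\in S\}$ be a fresh set of atomic propositions. Then the verifier wins $\mathcal{G}(\mathcal{T}^P,\varphi^{P,\Xi})$ from every node of $V_{\mathit{init}}$.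
   Context: $\Sigma=2^{\mathit{AP}}$ for a finite set $\mathit{AP}$; $t\otimes t'$ is the pointwise pair sequence. A transition system has finite $S$, $S_0\subseteq S$, $\varrho\subseteq S\times S$ with every state having a successor, $L:S\to\Sigma$; $\mathit{Traces}(\mathcal{T})$ are label sequences of infinite paths from initial states; $\mathcal{T}_s$ is $\mathcal{T}$ with initial state set $\{s\}$. A deterministic safety automaton $(Q,q_0,\delta,B)$ accepts a word iff its unique run never visits $B$; $\mathcal{A}_q$ is the automaton with initial state changed to $q$. HyperLTL semantics: quantifiers range over $\mathit{Traces}(\mathcal{T})$, matrix is LTL over $a_\pi$. QPTL extends LTL by propositional quantification $\tilde\exists q.\phi$; every $\omega$-regular set is QPTL-definable. Game $\mathcal{G}(\mathcal{T}',\psi)$ for $\psi=\forall\pi.\exists\pi'.\chi$ over a system $\mathcal{T}'=(S',S_0',\varrho',L')$: take a deterministic parity automaton $(Q,q_0,\delta,c)$ over pairs accepting exactly $t\otimes t'$ with $[\pi\mapsto t,\pi'\mapsto t']\models\chi$; verifier nodes $s\in S'$ (initial choice of refuter) and $\langle(s,s'),q,\exists\rangle$, refuter nodes $\langle(s,s'),q,\forall\rangle$; moves $s\to\langle(s,s'),q_0,\forall\rangle$ for $s'\in S_0'$; $\langle(s,s'),q,\forall\rangle\to\langle(u,s'),\delta(q,(L'(s),L'(s'))),\exists\rangle$ for $(s,u)\in\varrho'$; $\langle(s,s'),q,\exists\rangle\to\langle(s,u'),q,\forall\rangle$ for $(s',u')\in\varrho'$. Triple nodes have colour $c(q)$; verifier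 wins a play iff the minimal colour seen infinitely often is even; $V_{\mathit{init}}=S_0'$. $\mathcal{T}^P=(S\times2^P,S_0\times2^P,\varrho^P,L^P)$ with $((s,A),(s',A'))\in\varrho^P$ iff $(s,s')\in\varrho$, and $L^P(s,A)=L(s)\cup A$. For $\Xi=\{\xi_1,..,\xi_n\}$ and $P=\{p_1,..,p_n\}$ (with $p_j$ corresponding to $\xi_j$), $\varphi^{P,\Xi}=\forall\pi.\exists\pi'.\,[\mathsf{G}\bigwedge_j((p_j)_\pi\leftrightarrow\xi_j)]\to\phi$. -}

module Defs where

open import Data.Nat using (ℕ; zero; suc; _≤_; _<_; _+_; _*_)
open import Data.Nat.Divisibility using (_∣_)
open import Data.Bool using (Bool; true; false; T)
open import Data.Fin using (Fin; zero; suc; _↑ˡ_; _↑ʳ_; combine; _≟_)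
open import Data.Fin.Subset using (Subset)
open import Data.Vec using (Vec; lookup; _++_)
open import Data.List using (List; []; _∷_; foldr; map; concatMap; upTo; allFin)
open import Data.Product using (Σ; ∃; _×_; _,_; proj₁; proj₂)
open import Relation.Nullary using (¬_)
open import Relation.Nullary.Decidable using (⌊_⌋)
open import Relation.Binary.PropositionalEquality using (_≡_)
open import Function.Bundles using (_⇔_)

-- Alphabets and words.  AP = Fin k, Σ = 2^AP = Subset k (= Vec Bool k).

Letter : ℕ → Set
Letter k = Subset k

Word : Set → Set
Word A = ℕ → A

_⊗_ : {A B : Set} → Word A → Word B → Word (A × B)
(t ⊗ t') i = t i , t' i

record TS (S A : Set) : Set where
  field
    S₀    : S → Bool
    ϱ     : S → S → Bool
    total : (s : S) → Σ S (λ s' → T (ϱ s s'))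
    L     : S → A
open TS public

IsPathFrom : {S A : Set} → TS S A → S → (ℕ → S) → Set
IsPathFrom 𝒯 s ρ = (ρ 0 ≡ s) × ((i : ℕ) → T (ϱ 𝒯 (ρ i) (ρ (suc i))))

Traces : {S A : Set} → TS S A → Word A → Set
Traces {S} 𝒯 t =
  Σ (ℕ → S) λ ρ → T (S₀ 𝒯 (ρ 0)) × ((i : ℕ) → T (ϱ 𝒯 (ρ i) (ρ (suc i))))
                × ((i : ℕ) → t i ≡ L 𝒯 (ρ i))

_at_ : {n : ℕ} {A : Set} → TS (Fin n) A → Fin n → TS (Fin n) A
𝒯 at s = record { S₀ = λ s' → ⌊ s' ≟ s ⌋ ; ϱ = ϱ 𝒯 ; total = total 𝒯 ; L = L 𝒯 }

record DSA (m : ℕ) (A : Set) : Set where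
  field
    q₀ : Fin m
    δ  : Fin m → A → Fin m
    B  : Fin m → Bool
open DSA public

runS : {m : ℕ} {A : Set} → DSA m A → Word A → ℕ → Fin m
runS 𝒜 w zero    = q₀ 𝒜
runS 𝒜 w (suc i) = δ 𝒜 (runS 𝒜 w i) (w i)

AcceptsS : {m : ℕ} {A : Set} → DSA m A → Word A → Set
AcceptsS 𝒜 w = (i : ℕ) → B 𝒜 (runS 𝒜 w i) ≡ false

_from_ : {m : ℕ} {A : Set} → DSA m A → Fin m → DSA m A
𝒜 from q = record { q₀ = q ; δ = δ 𝒜 ; B = B 𝒜 }

InfOften : (ℕ → ℕ) → ℕ → Set
InfOften col c = (i : ℕ) → Σ ℕ λ j → (i ≤ j) × (col j ≡ c)

ParityWin : (ℕ → ℕ) → Set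
ParityWin col =
  (c : ℕ) → InfOften col c → ((c' : ℕ) → c' < c → ¬ InfOften col c') → 2 ∣ c

record DPA (m : ℕ) (A : Set) : Set where
  field
    q₀ : Fin m
    δ  : Fin m → A → Fin m
    c  : Fin m → ℕ

runP : {m : ℕ} {A : Set} → DPA m A → Word A → ℕ → Fin m
runP 𝒟 w zero    = DPA.q₀ 𝒟
runP 𝒟 w (suc i) = DPA.δ 𝒟 (runP 𝒟 w i) (w i)

AcceptsP : {m : ℕ} {A : Set} → DPA m A → Word A → Set
AcceptsP 𝒟 w = ParityWin (λ i → DPA.c 𝒟 (runP 𝒟 w i))

-- QPTL over atomic propositions X, with j bound (quantified)
-- propositions in scope (de Bruijn).  LTL = quantifier-free fragment.

data QPTL (X : Set) : ℕ → Set where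
  ⊤'   : ∀ {j} → QPTL X j
  atom : ∀ {j} → X → QPTL X j
  var  : ∀ {j} → Fin j → QPTL X j
  ¬'_  : ∀ {j} → QPTL X j → QPTL X j
  _∧'_ : ∀ {j} → QPTL X j → QPTL X j → QPTL X j
  X'_  : ∀ {j} → QPTL X j → QPTL X j
  _U'_ : ∀ {j} → QPTL X j → QPTL X j → QPTL X j
  ∃̃_   : ∀ {j} → QPTL X (suc j) → QPTL X j

data LTL (X : Set) : Set where
  ⊤'   : LTL X
  atom : X → LTL X
  ¬'_  : LTL X → LTL X
  _∧'_ : LTL X → LTL X → LTL X
  X'_  : LTL X → LTL X
  _U'_ : LTL X → LTL X → LTL X

ltl→qptl : {X : Set} → LTL X → QPTL X 0
ltl→qptl ⊤'        = ⊤'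
ltl→qptl (atom x)  = atom x
ltl→qptl (¬' φ)    = ¬' ltl→qptl φ
ltl→qptl (φ ∧' ψ)  = ltl→qptl φ ∧' ltl→qptl ψ
ltl→qptl (X' φ)    = X' ltl→qptl φ
ltl→qptl (φ U' ψ)  = ltl→qptl φ U' ltl→qptl ψ

_∨'_ : {X : Set} {j : ℕ} → QPTL X j → QPTL X j → QPTL X j
φ ∨' ψ = ¬' ((¬' φ) ∧' (¬' ψ))

_⇒'_ : {X : Set} {j : ℕ} → QPTL X j → QPTL X j → QPTL X j
φ ⇒' ψ = (¬' φ) ∨' ψ

_⇔'_ : {X : Set} {j : ℕ} → QPTL X j → QPTL X j → QPTL X j
φ ⇔' ψ = (φ ⇒' ψ) ∧' (ψ ⇒' φ)

G'_ : {X : Set} {j : ℕ} → QPTL X j → QPTL X j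
G' φ = ¬' (⊤' U' (¬' φ))

⋀' : {X : Set} {j : ℕ} → List (QPTL X j) → QPTL X j
⋀' = foldr _∧'_ ⊤'

rename : {X Y : Set} {j : ℕ} → (X → Y) → QPTL X j → QPTL Y j
rename f ⊤'       = ⊤'
rename f (atom x) = atom (f x)
rename f (var v)  = var v
rename f (¬' φ)   = ¬' rename f φ
rename f (φ ∧' ψ) = rename f φ ∧' rename f ψ
rename f (X' φ)   = X' rename f φ
rename f (φ U' ψ) = rename f φ U' rename f ψ
rename f (∃̃ φ)    = ∃̃ rename f φ

extend : {j : ℕ} → (ℕ → Fin j → Bool) → (ℕ → Bool) → ℕ → Fin (suc j) → Bool
extend e b i zero    = b i
extend e b i (suc v) = e i v

sem : {X : Set} {j : ℕ} → (ℕ → X → Bool) → (ℕ → Fin j → Bool) → ℕ → QPTL X j → Set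
sem w e i ⊤'       = Data.Unit.⊤ where import Data.Unit
sem w e i (atom x) = T (w i x)
sem w e i (var v)  = T (e i v)
sem w e i (¬' φ)   = ¬ sem w e i φ
sem w e i (φ ∧' ψ) = sem w e i φ × sem w e i ψ
sem w e i (X' φ)   = sem w e (suc i) φ
sem w e i (φ U' ψ) = Σ ℕ λ k → (i ≤ k) × sem w e k ψ
                      × ((l : ℕ) → i ≤ l → l < k → sem w e l φ)
sem w e i (∃̃ φ)    = Σ (ℕ → Bool) λ b → sem w (extend e b) i φ

noVars : ℕ → Fin 0 → Bool
noVars i ()

_⊨Q_ : {k : ℕ} → Word (Letter k) → QPTL (Fin k) 0 → Set
t ⊨Q ξ = sem (λ i a → lookup (t i) a) noVars 0 ξ

-- HyperLTL with two trace variables π (first), π' (second).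

data TVar : Set where
  π π′ : TVar

pairVal : {k : ℕ} → Word (Letter k) → Word (Letter k) → ℕ → TVar × Fin k → Bool
pairVal t t' i (π  , a) = lookup (t i) a
pairVal t t' i (π′ , a) = lookup (t' i) a

SatQ : {k : ℕ} → Word (Letter k) → Word (Letter k) → QPTL (TVar × Fin k) 0 → Set
SatQ t t' χ = sem (pairVal t t') noVars 0 χ

SatL : {k : ℕ} → Word (Letter k) → Word (Letter k) → LTL (TVar × Fin k) → Set
SatL t t' φ = SatQ t t' (ltl→qptl φ)

ModelsAE : {S : Set} {k : ℕ} → TS S (Letter k) → LTL (TVar × Fin k) → Set
ModelsAE 𝒯 φ = (t : Word _) → Traces 𝒯 t → Σ (Word _) λ t' → Traces 𝒯 t' × SatL t t' φ

𝔓 : {n k m : ℕ} → TS (Fin n) (Letter k) → DSA m (Letter k × Letter k)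
    → Fin m → Fin n → Word (Letter k) → Set
𝔓 𝒯 𝒜 q s t = Σ (Word _) λ t' → Traces (𝒯 at s) t' × AcceptsS (𝒜 from q) (t ⊗ t')

-- Extended propositions AP ∪ P with AP = Fin k, P = {p_{q,s}} ≅ Fin (m * n):
-- AP ∪ P = Fin (k + m * n), a ∈ AP ↦ a ↑ˡ (m * n), p_{q,s} ↦ k ↑ʳ combine q s.

embAP : {k : ℕ} (m n : ℕ) → Fin k → Fin (k + m * n)
embAP m n a = a ↑ˡ (m * n)

pProp : {k m n : ℕ} → Fin m → Fin n → Fin (k + m * n)
pProp {k} q s = k ↑ʳ combine q s

extTS : {n k : ℕ} (m : ℕ) → TS (Fin n) (Letter k) → TS (Fin n × Subset (m * n)) (Letter (k + m * n))
extTS m 𝒯 = record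
  { S₀    = λ sA → S₀ 𝒯 (proj₁ sA)
  ; ϱ     = λ sA sA' → ϱ 𝒯 (proj₁ sA) (proj₁ sA')
  ; total = λ sA → (proj₁ (total 𝒯 (proj₁ sA)) , proj₂ sA) , proj₂ (total 𝒯 (proj₁ sA))
  ; L     = λ sA → L 𝒯 (proj₁ sA) ++ proj₂ sA
  }

matrixPΞ : {k m n : ℕ} → (Fin m → Fin n → QPTL (Fin k) 0) → LTL (TVar × Fin k)
           → QPTL (TVar × Fin (k + m * n)) 0
matrixPΞ {k} {m} {n} ξ φ =
  (G' ⋀' (concatMap (λ q → map (λ s →
        atom (π , pProp q s) ⇔' rename (λ a → (π , embAP m n a)) (ξ q s))
      (allFin n)) (allFin m)))
  ⇒' rename (λ x → (proj₁ x , embAP m n (proj₂ x))) (ltl→qptl φ)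

module Game {S' : Set} {k' mq : ℕ} (𝒯' : TS S' (Letter k')) (𝒟 : DPA mq (Letter k' × Letter k')) where

  data Node : Set where
    initN : S' → Node
    refN  : S' → S' → Fin mq → Node
    verN  : S' → S' → Fin mq → Node

  data Edge : Node → Node → Set where
    e-init : {s s' : S'} → T (S₀ 𝒯' s') → Edge (initN s) (refN s s' (DPA.q₀ 𝒟))
    e-ref  : {s s' u : S'} {q : Fin mq} → T (ϱ 𝒯' s u)
             → Edge (refN s s' q) (verN u s' (DPA.δ 𝒟 q (L 𝒯' s , L 𝒯' s')))
    e-ver  : {s s' u' : S'} {q : Fin mq} → T (ϱ 𝒯' s' u')
             → Edge (verN s s' q) (refN s u' q)

  IsVerifierNode : Node → Set
  IsVerifierNode (initN _)    = Data.Unit.⊤ where import Data.Unit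
  IsVerifierNode (refN _ _ _) = Data.Empty.⊥ where import Data.Empty
  IsVerifierNode (verN _ _ _) = Data.Unit.⊤ where import Data.Unit

  colour : Node → ℕ
  colour (initN _)    = 0          -- visited at most once; irrelevant
  colour (refN _ _ q) = DPA.c 𝒟 q
  colour (verN _ _ q) = DPA.c 𝒟 q

  record Strategy : Set where
    field
      move  : List Node → Node → Node
      legal : (h : List Node) (v : Node) → IsVerifierNode v → Edge v (move h v)

  ConsistentPlay : Strategy → Node → (ℕ → Node) → Set
  ConsistentPlay σ v ρ =
    (ρ 0 ≡ v) ×
    ((i : ℕ) → Edge (ρ i) (ρ (suc i))) ×
    ((i : ℕ) → IsVerifierNode (ρ i) → ρ (suc i) ≡ Strategy.move σ (map ρ (upTo i)) (ρ i))

  VerifierWinsFrom : Node → Set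
  VerifierWinsFrom v =
    Σ Strategy λ σ → (ρ : ℕ → Node) → ConsistentPlay σ v ρ → ParityWin (λ i → colour (ρ i))

  -- V_init = S₀'
  VerifierWinsFromAllInit : Set
  VerifierWinsFromAllInit = (s : S') → T (S₀ 𝒯' s) → VerifierWinsFrom (initN s)

Recognises : {k' mq : ℕ} → DPA mq (Letter k' × Letter k') → QPTL (TVar × Fin k') 0 → Set
Recognises 𝒟 χ = (t t' : Word _) → AcceptsP 𝒟 (t ⊗ t') ⇔ SatQ t t' χ

-- In 𝒯^P the refuter's trace also carries the propositions p_{q,s}. If it violates
-- G ⋀ (p_{q,s} ↔ ξ_{q,s}) the matrix of φ^{P,Ξ} holds vacuously; otherwise p_{q,s}
-- holds at position i exactly when the suffix of the refuter's trace from i lies in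
-- 𝔓_{q,s}. The verifier therefore moves to a state s for which p_{q,s} is set, q being
-- the current state of 𝒜^φ on the two traces. Such an s exists initially because
-- 𝒯 ⊨ φ, and it persists because a witness for 𝔓_{q,s} passes through a successor u
-- of s with the next suffix in 𝔓_{δ(q,·),u}. As 𝔓_{q,s} is empty for q ∈ B, the run of
-- 𝒜^φ avoids B, so the two traces satisfy φ; the run of the parity automaton on them
-- is the sequence of colours of the play, which is therefore won.

module Submission where

open import Defs
open import Level using (0ℓ)
open import Data.Nat using (ℕ; zero; suc; _+_; _*_; _∸_; _≤_; _<_; z≤n; s≤s)
open import Data.Nat.Properties
  using ( ≤-trans; n≤1+n; +-suc; +-assoc; +-identityʳ; m≤m+n; +-monoʳ-≤; +-monoʳ-<
        ; +-cancelˡ-<; m+n∸m≡n; m≤n⇒∃[o]m+o≡n )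
open import Data.Bool using (Bool; false; T)
open import Data.Bool.Properties using (T?) renaming (_≟_ to _≟ᵇ_)
open import Data.Unit using (tt)
open import Data.Product using (∃; _×_; _,_; proj₁; proj₂)
open import Data.Product.Function.NonDependent.Propositional using (_×-⇔_)
open import Data.Fin using (Fin; zero; suc)
open import Data.Fin.Properties using (any?)
open import Data.Fin.Subset using (Subset) renaming (⊥ to ∅)
open import Data.Vec using (lookup)
open import Data.Vec.Properties using (lookup-++ˡ)
open import Data.List
  using (List; _∷_; [_]; foldl; map; upTo; allFin; concatMap) renaming (_++_ to _++L_)
open import Data.List.Properties using (foldl-∷ʳ; map-++; upTo-∷ʳ)
open import Data.List.Membership.Propositional using (_∈_)
open import Data.List.Membership.Propositional.Properties using (∈-allFin; ∈-map⁺; ∈-concatMap⁺)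
open import Data.List.Relation.Unary.Any as Any using (here; there)
open import Relation.Unary using (Pred; _⊆_)
open import Relation.Nullary using (¬_; Dec; yes; no; contradiction)
open import Relation.Nullary.Decidable using (_×-dec_; decidable-stable; toWitness; fromWitness)
open import Relation.Nullary.Negation using (¬¬-map)
open import Relation.Binary.PropositionalEquality
  using (_≡_; refl; sym; trans; cong; cong₂; subst; subst₂; module ≡-Reasoning)
open import Function.Base using (_∘_)
open import Function.Bundles using (_⇔_; mk⇔; Equivalence)
open import Function.Related.TypeIsomorphisms using (¬-cong-⇔)
import Function.Properties.Equivalence as ⇔

open ≡-Reasoning
open Equivalence using () renaming (to to ⇔-to; from to ⇔-from)

T-cong : {a b : Bool} → a ≡ b → T a ⇔ T b
T-cong refl = ⇔.refl

≤-offset : ∀ d {i k} → d + i ≤ k → ∃ λ k' → i ≤ k' × k ≡ d + k'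
≤-offset d {i} d+i≤k with m≤n⇒∃[o]m+o≡n d+i≤k
... | o , refl = i + o , m≤m+n i o , +-assoc d i o

extend-shift : ∀ {j} d {e e' : ℕ → Fin j → Bool} {b b' : ℕ → Bool}
  → (∀ l v → e' l v ≡ e (d + l) v) → (∀ l → b' l ≡ b (d + l))
  → ∀ l v → extend e' b' l v ≡ extend e b (d + l) v
extend-shift d he hb l zero    = hb l
extend-shift d he hb l (suc v) = he l v

module _ {X Y : Set} (f : X → Y) (d : ℕ) {w : ℕ → Y → Bool} {w' : ℕ → X → Bool}
         (hw : ∀ i x → w' i x ≡ w (d + i) (f x)) where

  sem-rename-shift : ∀ {j} {e e' : ℕ → Fin j → Bool} → (∀ i v → e' i v ≡ e (d + i) v)
    → (φ : QPTL X j) (i : ℕ) → sem w e (d + i) (rename f φ) ⇔ sem w' e' i φ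
  sem-rename-shift he ⊤'       i = ⇔.refl
  sem-rename-shift he (atom x) i = T-cong (sym (hw i x))
  sem-rename-shift he (var v)  i = T-cong (sym (he i v))
  sem-rename-shift he (¬' φ)   i = ¬-cong-⇔ (sem-rename-shift he φ i)
  sem-rename-shift he (φ ∧' ψ) i = sem-rename-shift he φ i ×-⇔ sem-rename-shift he ψ i
  sem-rename-shift {e = e} {e'} he (X' φ) i =
    subst (λ l → sem w e l (rename f φ) ⇔ sem w' e' (suc i) φ) (+-suc d i) (sem-rename-shift he φ (suc i))
  sem-rename-shift {e = e} {e'} he (φ U' ψ) i = mk⇔ shiftBack shiftForth
    where
    IH : ∀ χ l → sem w e (d + l) (rename f χ) ⇔ sem w' e' l χ
    IH χ = sem-rename-shift he χ
    shiftBack : sem w e (d + i) (rename f (φ U' ψ)) → sem w' e' i (φ U' ψ)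
    shiftBack (k , d+i≤k , ψk , φ<k) with ≤-offset d d+i≤k
    ... | k' , i≤k' , refl =
      k' , i≤k' , ⇔-to (IH ψ k') ψk ,
      λ l i≤l l<k' → ⇔-to (IH φ l) (φ<k (d + l) (+-monoʳ-≤ d i≤l) (+-monoʳ-< d l<k'))
    shiftForth : sem w' e' i (φ U' ψ) → sem w e (d + i) (rename f (φ U' ψ))
    shiftForth (k' , i≤k' , ψk' , φ<k') =
      d + k' , +-monoʳ-≤ d i≤k' , ⇔-from (IH ψ k') ψk' , φ≤
      where
      φ≤ : ∀ l → d + i ≤ l → l < d + k' → sem w e l (rename f φ)
      φ≤ l d+i≤l l<d+k' with ≤-offset d d+i≤l
      ... | l' , i≤l' , refl = ⇔-from (IH φ l') (φ<k' l' i≤l' (+-cancelˡ-< d l' k' l<d+k'))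
  sem-rename-shift {e = e} {e'} he (∃̃ φ) i = mk⇔
    (λ (b , φb) → (λ l → b (d + l)) ,
       ⇔-to (sem-rename-shift (extend-shift d he (λ _ → refl)) φ i) φb)
    (λ (b' , φb') → (λ l → b' (l ∸ d)) ,
       ⇔-from (sem-rename-shift (extend-shift d he (λ l → cong b' (sym (m+n∸m≡n d l)))) φ i) φb')

module Connectives {X : Set} {j : ℕ} (w : ℕ → X → Bool) (e : ℕ → Fin j → Bool) where

  ⋀'-elim : ∀ {i χ} (χs : List (QPTL X j)) → sem w e i (⋀' χs) → χ ∈ χs → sem w e i χ
  ⋀'-elim (_ ∷ _)  (h , _)  (here refl) = h
  ⋀'-elim (_ ∷ χs) (_ , hs) (there χ∈)  = ⋀'-elim χs hs χ∈

  G'-elim : ∀ {i χ} → sem w e i (G' χ) → ∀ l → i ≤ l → ¬ ¬ sem w e l χ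
  G'-elim hG l i≤l ¬χ = hG (l , i≤l , ¬χ , λ _ _ _ → tt)

  ⇒'-elim : ∀ {i χ ψ} → sem w e i (χ ⇒' ψ) → sem w e i χ → ¬ ¬ sem w e i ψ
  ⇒'-elim h χ ¬ψ = h ((λ ¬χ → ¬χ χ) , ¬ψ)

  ⇒'-intro : ∀ {i χ ψ} → (sem w e i χ → sem w e i ψ) → sem w e i (χ ⇒' ψ)
  ⇒'-intro f (¬¬χ , ¬ψ) = ¬¬χ (λ χ → ¬ψ (f χ))

  atom-⇔'-to : ∀ {i x χ} → ¬ ¬ sem w e i (atom x ⇔' χ) → T (w i x) → ¬ ¬ sem w e i χ
  atom-⇔'-to {χ = χ} h x ¬χ = h (λ (x⇒χ , _) → ⇒'-elim {χ = atom _} {χ} x⇒χ x ¬χ)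

  atom-⇔'-from : ∀ {i x χ} → ¬ ¬ sem w e i (atom x ⇔' χ) → sem w e i χ → T (w i x)
  atom-⇔'-from {χ = χ} h χ-holds =
    decidable-stable (T? _) (λ ¬x → h (λ (_ , χ⇒x) → ⇒'-elim {χ = χ} {atom _} χ⇒x χ-holds ¬x))

module _ {n : ℕ} {P : Pred (Fin n) 0ℓ} (default : Fin n) where

  pick : Dec (∃ P) → Fin n
  pick (yes (x , _)) = x
  pick (no _)        = default

  pick-∃ : (P? : Dec (∃ P)) → ∃ P → P (pick P?)
  pick-∃ (yes (_ , Px)) _   = Px
  pick-∃ (no ¬∃P)       ∃P = contradiction ∃P ¬∃P

  pick-⊆ : {Q : Pred (Fin n) 0ℓ} (P? : Dec (∃ P)) → P ⊆ Q → Q default → Q (pick P?)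
  pick-⊆ (yes (_ , Px)) P⊆Q _  = P⊆Q Px
  pick-⊆ (no _)         _   Qd = Qd

-- Recursive so that suffix (suc d) w is definitionally the tail suffix 1 (suffix d w).
suffix : {A : Set} → ℕ → Word A → Word A
suffix zero    w = w
suffix (suc d) w = λ j → suffix d w (suc j)

suffix-apply : {A : Set} (d : ℕ) (w : Word A) (j : ℕ) → suffix d w j ≡ w (d + j)
suffix-apply zero    w j = refl
suffix-apply (suc d) w j = trans (suffix-apply d w (suc j)) (cong w (+-suc d j))

suffix-head : {A : Set} (d : ℕ) (w : Word A) → suffix d w 0 ≡ w d
suffix-head d w = trans (suffix-apply d w 0) (cong w (+-identityʳ d))

runS-tail : {m : ℕ} {A : Set} (𝒜 : DSA m A) (q : Fin m) (w : Word A) (i : ℕ)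
  → runS (𝒜 from δ 𝒜 q (w 0)) (suffix 1 w) i ≡ runS (𝒜 from q) w (suc i)
runS-tail 𝒜 q w zero    = refl
runS-tail 𝒜 q w (suc i) = cong (λ q' → δ 𝒜 q' (w (suc i))) (runS-tail 𝒜 q w i)

module _ {n k m : ℕ} (𝒯 : TS (Fin n) (Letter k)) (𝒜 : DSA m (Letter k × Letter k)) where

  𝔓-step : ∀ {q s t} → 𝔓 𝒯 𝒜 q s t
    → B 𝒜 q ≡ false × ∃ λ u → T (ϱ 𝒯 s u) × 𝔓 𝒯 𝒜 (δ 𝒜 q (t 0 , L 𝒯 s)) u (suffix 1 t)
  𝔓-step {q} {s} {t} (t' , (ρ' , ρ'₀≟s , path , lab) , acc) =
    acc 0 , ρ' 1 , subst (λ s' → T (ϱ 𝒯 s' (ρ' 1))) ρ'₀≡s (path 0) ,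
    suffix 1 t' , (suffix 1 ρ' , fromWitness refl , (λ i → path (suc i)) , (λ i → lab (suc i))) , acc-tail
    where
    ρ'₀≡s : ρ' 0 ≡ s
    ρ'₀≡s = toWitness ρ'₀≟s
    acc-tail : AcceptsS (𝒜 from δ 𝒜 q (t 0 , L 𝒯 s)) (suffix 1 t ⊗ suffix 1 t')
    acc-tail i =
      subst (λ a → B 𝒜 (runS (𝒜 from δ 𝒜 q (t 0 , a)) (suffix 1 (t ⊗ t')) i) ≡ false)
            (trans (lab 0) (cong (L 𝒯) ρ'₀≡s))
            (trans (cong (B 𝒜) (runS-tail 𝒜 q (t ⊗ t') i)) (acc (suc i)))

  𝔓-initial : ∀ {φ} → ((t t' : Word (Letter k)) → SatL t t' φ ⇔ AcceptsS 𝒜 (t ⊗ t'))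
    → ModelsAE 𝒯 φ → ∀ {t} → Traces 𝒯 t → ∃ λ s → T (S₀ 𝒯 s) × 𝔓 𝒯 𝒜 (q₀ 𝒜) s t
  𝔓-initial hφ hM {t} t∈𝒯 with hM t t∈𝒯
  ... | t' , (ρ' , init , path , lab) , sat =
    ρ' 0 , init , t' , (ρ' , fromWitness refl , path , lab) , ⇔-to (hφ t t') sat

-- A play visits the initial node, then the i-th refuter node at position 2i+1
-- and the i-th verifier node at position 2i+2.
refIx : ℕ → ℕ
refIx zero    = 1
refIx (suc i) = suc (suc (refIx i))

verIx : ℕ → ℕ
verIx i = suc (refIx i)

data PlayIndex : ℕ → Set where
  initial  : PlayIndex 0
  refuter  : ∀ i → PlayIndex (refIx i)
  verifier : ∀ i → PlayIndex (verIx i)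

playIndex : ∀ j → PlayIndex j
playIndex zero = initial
playIndex (suc j) with playIndex j
... | initial    = refuter 0
... | refuter i  = verifier i
... | verifier i = refuter (suc i)

refIx≰0 : ∀ i → ¬ refIx i ≤ 0
refIx≰0 zero    ()
refIx≰0 (suc i) ()

i≤refIx : ∀ i → i ≤ refIx i
i≤refIx zero    = z≤n
i≤refIx (suc i) = ≤-trans (s≤s (i≤refIx i)) (n≤1+n _)

refIx-cancel-≤ : ∀ {i i'} → refIx i ≤ refIx i' → i ≤ i'
refIx-cancel-≤ {zero}              _               = z≤n
refIx-cancel-≤ {suc i} {zero}      (s≤s ())
refIx-cancel-≤ {suc i} {suc i'}    (s≤s (s≤s le)) = s≤s (refIx-cancel-≤ le)

module _ {col cr : ℕ → ℕ} (col-ref : ∀ i → col (refIx i) ≡ cr i)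
         (col-ver : ∀ i → col (verIx i) ≡ cr (suc i)) where

  InfOften-interleave⁺ : ∀ {c} → InfOften cr c → InfOften col c
  InfOften-interleave⁺ inf i with inf i
  ... | j , i≤j , crj = refIx j , ≤-trans i≤j (i≤refIx j) , trans (col-ref j) crj

  InfOften-interleave⁻ : ∀ {c} → InfOften col c → InfOften cr c
  InfOften-interleave⁻ inf i with inf (refIx i)
  ... | j , le , colj with playIndex j
  ... | initial     = contradiction le (refIx≰0 i)
  ... | refuter i'  = i' , refIx-cancel-≤ le , trans (sym (col-ref i')) colj
  ... | verifier i' =
    suc i' , refIx-cancel-≤ (≤-trans le (n≤1+n _)) , trans (sym (col-ver i')) colj

  ParityWin-interleave : ParityWin cr → ParityWin col
  ParityWin-interleave win c inf minimal =
    win c (InfOften-interleave⁻ inf) (λ c' c'<c inf' → minimal c' c'<c (InfOften-interleave⁺ inf'))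

module Plays {S' : Set} {k' mq : ℕ} (𝒯' : TS S' (Letter k')) (𝒟 : DPA mq (Letter k' × Letter k')) where
  open Game 𝒯' 𝒟

  refuterPos verifierPos : Node → S'
  refuterPos (initN y)    = y
  refuterPos (refN y _ _) = y
  refuterPos (verN y _ _) = y
  verifierPos (initN y)    = y
  verifierPos (refN _ z _) = z
  verifierPos (verN _ z _) = z

  edge-from-init : ∀ {y v} → Edge (initN y) v → ∃ λ z → v ≡ refN y z (DPA.q₀ 𝒟)
  edge-from-init (e-init _) = _ , refl

  edge-from-ref : ∀ {y z q v} → Edge (refN y z q) v
    → ∃ λ u → T (ϱ 𝒯' y u) × v ≡ verN u z (DPA.δ 𝒟 q (L 𝒯' y , L 𝒯' z))
  edge-from-ref (e-ref ϱu) = _ , ϱu , refl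

  edge-from-ver : ∀ {y z q v} → Edge (verN y z q) v → ∃ λ u → v ≡ refN y u q
  edge-from-ver (e-ver _) = _ , refl

  refN-positions : ∀ {v y z q} → v ≡ refN y z q → v ≡ refN (refuterPos v) (verifierPos v) q
  refN-positions refl = refl

  module Play {x : S'} {ρ : ℕ → Node} (ρ₀ : ρ 0 ≡ initN x)
              (edges : ∀ i → Edge (ρ i) (ρ (suc i))) where

    refState verState : ℕ → S'
    refState i = refuterPos (ρ (refIx i))
    verState i = verifierPos (ρ (refIx i))

    refTrace verTrace : Word (Letter k')
    refTrace i = L 𝒯' (refState i)
    verTrace i = L 𝒯' (verState i)

    run : ℕ → Fin mq
    run = runP 𝒟 (refTrace ⊗ verTrace)

    edge-at : ∀ j {v} → ρ j ≡ v → Edge v (ρ (suc j))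
    edge-at j eq = subst (λ v → Edge v (ρ (suc j))) eq (edges j)

    initial-move : ∃ λ z → ρ 1 ≡ refN x z (DPA.q₀ 𝒟)
    initial-move = edge-from-init (edge-at 0 ρ₀)

    refState-0 : refState 0 ≡ x
    refState-0 = cong refuterPos (proj₂ initial-move)

    refState-suc : ∀ i {y z q} → ρ (verIx i) ≡ verN y z q → refState (suc i) ≡ y
    refState-suc i eq = cong refuterPos (proj₂ (edge-from-ver (edge-at (verIx i) eq)))

    ρ-ref : ∀ i → ρ (refIx i) ≡ refN (refState i) (verState i) (run i)
    refuter-move : ∀ i → T (ϱ 𝒯' (refState i) (refState (suc i)))
                       × ρ (verIx i) ≡ verN (refState (suc i)) (verState i) (run (suc i))

    ρ-ref zero    = refN-positions (proj₂ initial-move)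
    ρ-ref (suc i) = refN-positions (proj₂ (edge-from-ver (edge-at (verIx i) (proj₂ (refuter-move i)))))
    refuter-move i =
      let (u , ϱu , eq) = edge-from-ref (edge-at (refIx i) (ρ-ref i))
      in subst (λ y → T (ϱ 𝒯' (refState i) y) × ρ (verIx i) ≡ verN y (verState i) (run (suc i)))
               (sym (refState-suc i eq)) (ϱu , eq)

    ρ-ver : ∀ i → ρ (verIx i) ≡ verN (refState (suc i)) (verState i) (run (suc i))
    ρ-ver i = proj₂ (refuter-move i)

    won-if-accepted : AcceptsP 𝒟 (refTrace ⊗ verTrace) → ParityWin (λ i → colour (ρ i))
    won-if-accepted = ParityWin-interleave (λ i → cong colour (ρ-ref i)) (λ i → cong colour (ρ-ver i))

∈-concatMap-allFin : {A : Set} {m n : ℕ} (f : Fin m → Fin n → A) (q : Fin m) (s : Fin n)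
  → f q s ∈ concatMap (λ q' → map (f q') (allFin n)) (allFin m)
∈-concatMap-allFin f q s =
  ∈-concatMap⁺ _ (Any.map (λ { refl → ∈-map⁺ (f q) (∈-allFin s) }) (∈-allFin q))

lookup-extTS-AP : {n k : ℕ} (m : ℕ) (𝒯 : TS (Fin n) (Letter k)) (y : Fin n × Subset (m * n))
  (a : Fin k) → lookup (L (extTS m 𝒯) y) (embAP m n a) ≡ lookup (L 𝒯 (proj₁ y)) a
lookup-extTS-AP m 𝒯 (s , A) a = lookup-++ˡ (L 𝒯 s) A a

module Flagging {n k m : ℕ} (𝒯 : TS (Fin n) (Letter k)) (𝒜 : DSA m (Letter k × Letter k))
                {mq : ℕ} (𝒟 : DPA mq (Letter (k + m * n) × Letter (k + m * n))) where
  open Game (extTS m 𝒯) 𝒟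

  State : Set
  State = Fin n × Subset (m * n)

  Flags : State → Fin m → Fin n → Set
  Flags y q s = T (lookup (L (extTS m 𝒯) y) (pProp q s))

  -- Game nodes carry the state of 𝒟, not of 𝒜; the verifier recomputes the
  -- latter from the history.
  track : Fin m → Node → Fin m
  track q (initN _)    = q
  track q (refN y z _) = δ 𝒜 q (L 𝒯 (proj₁ y) , L 𝒯 (proj₁ z))
  track q (verN _ _ _) = q

  historyState : List Node → Fin m
  historyState = foldl track (q₀ 𝒜)

  historyState-upTo-suc : (ρ : ℕ → Node) (j : ℕ)
    → historyState (map ρ (upTo (suc j))) ≡ track (historyState (map ρ (upTo j))) (ρ j)
  historyState-upTo-suc ρ j = begin
    historyState (map ρ (upTo (suc j)))        ≡⟨ cong (historyState ∘ map ρ) (sym (upTo-∷ʳ j)) ⟩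
    historyState (map ρ (upTo j ++L [ j ]))    ≡⟨ cong historyState (map-++ ρ (upTo j) [ j ]) ⟩
    historyState (map ρ (upTo j) ++L [ ρ j ])  ≡⟨ foldl-∷ʳ track (q₀ 𝒜) (ρ j) (map ρ (upTo j)) ⟩
    track (historyState (map ρ (upTo j))) (ρ j) ∎

  InitialCandidate : State → Pred (Fin n) 0ℓ
  InitialCandidate y s = T (S₀ 𝒯 s) × Flags y (q₀ 𝒜) s

  NextCandidate : List Node → State → State → Pred (Fin n) 0ℓ
  NextCandidate h y z u = T (ϱ 𝒯 (proj₁ z) u) × Flags y (historyState h) u

  initialCandidate? : (y : State) → Dec (∃ (InitialCandidate y))
  initialCandidate? y = any? λ s → T? _ ×-dec T? _

  nextCandidate? : (h : List Node) (y z : State) → Dec (∃ (NextCandidate h y z))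
  nextCandidate? h y z = any? λ u → T? _ ×-dec T? _

  module FlagStrategy (s₀ : Fin n) (s₀-init : T (S₀ 𝒯 s₀)) where

    initialChoice : State → Fin n
    initialChoice y = pick s₀ (initialCandidate? y)

    nextChoice : List Node → State → State → Fin n
    nextChoice h y z = pick (proj₁ (total 𝒯 (proj₁ z))) (nextCandidate? h y z)

    -- The P-part of the verifier's states is never read, and refuter nodes are never
    -- consulted.
    verifierMove : List Node → Node → Node
    verifierMove h (initN y)    = refN y (initialChoice y , ∅) (DPA.q₀ 𝒟)
    verifierMove h (refN y z q) = refN y z q
    verifierMove h (verN y z q) = refN y (nextChoice h y z , ∅) q

    verifierMove-legal : (h : List Node) (v : Node) → IsVerifierNode v → Edge v (verifierMove h v)
    verifierMove-legal h (initN y)    _ = e-init (pick-⊆ s₀ (initialCandidate? y) proj₁ s₀-init)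
    verifierMove-legal h (verN y z q) _ =
      e-ver (pick-⊆ _ (nextCandidate? h y z) proj₁ (proj₂ (total 𝒯 (proj₁ z))))

    strategy : Strategy
    strategy = record { move = verifierMove ; legal = verifierMove-legal }

module FlagStrategyWins {n k m : ℕ} (𝒯 : TS (Fin n) (Letter k)) (𝒜 : DSA m (Letter k × Letter k))
  {φ : LTL (TVar × Fin k)} (hφ : (t t' : Word (Letter k)) → SatL t t' φ ⇔ AcceptsS 𝒜 (t ⊗ t'))
  (hM : ModelsAE 𝒯 φ)
  {ξ : Fin m → Fin n → QPTL (Fin k) 0}
  (hξ : (q : Fin m) (s : Fin n) (t : Word (Letter k)) → (t ⊨Q ξ q s) ⇔ 𝔓 𝒯 𝒜 q s t)
  {mq : ℕ} (𝒟 : DPA mq (Letter (k + m * n) × Letter (k + m * n))) (hD : Recognises 𝒟 (matrixPΞ ξ φ))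
  (x : Fin n × Subset (m * n)) (x-init : T (S₀ 𝒯 (proj₁ x))) where
  open Game (extTS m 𝒯) 𝒟
  open Plays (extTS m 𝒯) 𝒟
  open Flagging 𝒯 𝒜 𝒟
  open FlagStrategy (proj₁ x) x-init

  embπ : Fin k → TVar × Fin (k + m * n)
  embπ a = π , embAP m n a

  embAP² : TVar × Fin k → TVar × Fin (k + m * n)
  embAP² (v , a) = v , embAP m n a

  flagConstraint : Fin m → Fin n → QPTL (TVar × Fin (k + m * n)) 0
  flagConstraint q s = atom (π , pProp q s) ⇔' rename embπ (ξ q s)

  flagConstraints : QPTL (TVar × Fin (k + m * n)) 0
  flagConstraints = ⋀' (concatMap (λ q → map (flagConstraint q) (allFin n)) (allFin m))

  module OnPlay {ρ : ℕ → Node} (cp : ConsistentPlay strategy (initN x) ρ) where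
    open Play (proj₁ cp) (proj₁ (proj₂ cp))

    rt rt' : Word (Letter k)
    rt i  = L 𝒯 (proj₁ (refState i))
    rt' i = L 𝒯 (proj₁ (verState i))

    qA : ℕ → Fin m
    qA = runS 𝒜 (rt ⊗ rt')

    history : ℕ → List Node
    history j = map ρ (upTo j)

    history-ref : ∀ i → historyState (history (refIx i)) ≡ qA i
    history-ver : ∀ i → historyState (history (verIx i)) ≡ qA (suc i)
    history-ref zero    = cong (track (q₀ 𝒜)) (proj₁ cp)
    history-ref (suc i) = trans (historyState-upTo-suc ρ (verIx i)) (cong₂ track (history-ver i) (ρ-ver i))
    history-ver i       = trans (historyState-upTo-suc ρ (refIx i)) (cong₂ track (history-ref i) (ρ-ref i))

    verifier-follows : ∀ j {v} → ρ j ≡ v → IsVerifierNode v → ρ (suc j) ≡ verifierMove (history j) v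
    verifier-follows j refl = proj₂ (proj₂ cp) j

    verState-0 : proj₁ (verState 0) ≡ initialChoice x
    verState-0 = cong (proj₁ ∘ verifierPos) (verifier-follows 0 (proj₁ cp) tt)

    verState-suc : ∀ i → proj₁ (verState (suc i)) ≡ nextChoice (history (verIx i)) (refState (suc i)) (verState i)
    verState-suc i = cong (proj₁ ∘ verifierPos) (verifier-follows (verIx i) (ρ-ver i) tt)

    rt-trace : Traces 𝒯 rt
    rt-trace = proj₁ ∘ refState , subst (λ y → T (S₀ 𝒯 (proj₁ y))) (sym refState-0) x-init ,
               (λ i → proj₁ (refuter-move i)) , (λ _ → refl)

    𝔓-next : ∀ i → 𝔓 𝒯 𝒜 (qA i) (proj₁ (verState i)) (suffix i rt)
      → ∃ λ u → T (ϱ 𝒯 (proj₁ (verState i)) u) × 𝔓 𝒯 𝒜 (qA (suc i)) u (suffix (suc i) rt)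
    𝔓-next i p =
      let (_ , u , ϱu , p') = 𝔓-step 𝒯 𝒜 p
      in u , ϱu , subst (λ a → 𝔓 𝒯 𝒜 (δ 𝒜 (qA i) (a , rt' i)) u (suffix (suc i) rt)) (suffix-head i rt) p'

    W : ℕ → TVar × Fin (k + m * n) → Bool
    W = pairVal refTrace verTrace

    open Connectives W noVars

    ξ-at : ∀ d q s → sem W noVars d (rename embπ (ξ q s)) ⇔ 𝔓 𝒯 𝒜 q s (suffix d rt)
    ξ-at d q s = ⇔.trans (subst (λ l → sem W noVars l (rename embπ (ξ q s)) ⇔ (suffix d rt ⊨Q ξ q s))
                                (+-identityʳ d)
                                (sem-rename-shift embπ d hw {e = noVars} {noVars} (λ _ ()) (ξ q s) 0))
                         (hξ q s (suffix d rt))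
      where
      hw : ∀ i a → lookup (suffix d rt i) a ≡ W (d + i) (π , embAP m n a)
      hw i a = trans (cong (λ l → lookup l a) (suffix-apply d rt i))
                     (sym (lookup-extTS-AP m 𝒯 (refState (d + i)) a))

    -- G' is a negated until, so the constraints hold only up to double negation;
    -- flags are Booleans and hence stable.
    module _ (hG : sem W noVars 0 (G' flagConstraints)) where

      constraint-holds : ∀ d q s → ¬ ¬ sem W noVars d (flagConstraint q s)
      constraint-holds d q s =
        ¬¬-map (λ all → ⋀'-elim {χ = flagConstraint q s} _ all (∈-concatMap-allFin flagConstraint q s))
               (G'-elim {χ = flagConstraints} hG d z≤n)

      flag⇒𝔓 : ∀ d q s → Flags (refState d) q s → ¬ ¬ 𝔓 𝒯 𝒜 q s (suffix d rt)
      flag⇒𝔓 d q s f = ¬¬-map (⇔-to (ξ-at d q s))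
        (atom-⇔'-to {x = π , pProp q s} {rename embπ (ξ q s)} (constraint-holds d q s) f)

      𝔓⇒flag : ∀ d q s → 𝔓 𝒯 𝒜 q s (suffix d rt) → Flags (refState d) q s
      𝔓⇒flag d q s p = atom-⇔'-from {x = π , pProp q s} {rename embπ (ξ q s)}
        (constraint-holds d q s) (⇔-from (ξ-at d q s) p)

      verifier-flagged : ∀ i → Flags (refState i) (qA i) (proj₁ (verState i))
      verifier-flagged zero =
        let (s , s-init , p) = 𝔓-initial 𝒯 𝒜 {φ} hφ hM rt-trace
            candidate : InitialCandidate x s
            candidate = s-init , subst (λ y → Flags y (q₀ 𝒜) s) refState-0 (𝔓⇒flag 0 (q₀ 𝒜) s p)
        in subst₂ (λ y s' → Flags y (q₀ 𝒜) s') (sym refState-0) (sym verState-0)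
                  (proj₂ (pick-∃ (proj₁ x) (initialCandidate? x) (s , candidate)))
      verifier-flagged (suc i) = decidable-stable (T? _) (¬¬-map next (flag⇒𝔓 i _ _ (verifier-flagged i)))
        where
        h : List Node
        h = history (verIx i)
        next : 𝔓 𝒯 𝒜 (qA i) (proj₁ (verState i)) (suffix i rt)
             → Flags (refState (suc i)) (qA (suc i)) (proj₁ (verState (suc i)))
        next p =
          let (u , ϱu , p') = 𝔓-next i p
              candidate : NextCandidate h (refState (suc i)) (verState i) u
              candidate = ϱu , subst (λ q → Flags (refState (suc i)) q u) (sym (history-ver i))
                                     (𝔓⇒flag (suc i) _ u p')
          in subst₂ (λ q s' → Flags (refState (suc i)) q s') (history-ver i) (sym (verState-suc i))
                    (proj₂ (pick-∃ _ (nextCandidate? h (refState (suc i)) (verState i)) (u , candidate)))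

      accepted : AcceptsS 𝒜 (rt ⊗ rt')
      accepted i = decidable-stable (B 𝒜 (qA i) ≟ᵇ false)
                     (¬¬-map (proj₁ ∘ 𝔓-step 𝒯 𝒜) (flag⇒𝔓 i _ _ (verifier-flagged i)))

    matrix-holds : SatQ refTrace verTrace (matrixPΞ ξ φ)
    matrix-holds = ⇒'-intro {χ = G' flagConstraints} {rename embAP² (ltl→qptl φ)}
                     λ hG → ⇔-from φ-at (⇔-from (hφ rt rt') (accepted hG))
      where
      hw : ∀ i y → pairVal rt rt' i y ≡ W i (embAP² y)
      hw i (π  , a) = sym (lookup-extTS-AP m 𝒯 (refState i) a)
      hw i (π′ , a) = sym (lookup-extTS-AP m 𝒯 (verState i) a)
      φ-at : sem W noVars 0 (rename embAP² (ltl→qptl φ)) ⇔ SatL rt rt' φ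
      φ-at = sem-rename-shift embAP² 0 hw {e = noVars} {noVars} (λ _ ()) (ltl→qptl φ) 0

    wins : ParityWin (λ i → colour (ρ i))
    wins = won-if-accepted (⇔-from (hD refTrace verTrace) matrix-holds)

  flagStrategy-wins : VerifierWinsFrom (initN x)
  flagStrategy-wins = strategy , λ _ cp → OnPlay.wins cp

theorem5 : {n k m : ℕ} (𝒯 : TS (Fin n) (Letter k)) (𝒜 : DSA m (Letter k × Letter k))
           (φ : LTL (TVar × Fin k))
           → ((t t' : Word (Letter k)) → SatL t t' φ ⇔ AcceptsS 𝒜 (t ⊗ t'))
           → ModelsAE 𝒯 φ
           → (ξ : Fin m → Fin n → QPTL (Fin k) 0)
           → ((q : Fin m) (s : Fin n) (t : Word (Letter k)) → (t ⊨Q ξ q s) ⇔ 𝔓 𝒯 𝒜 q s t)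
           → {mq : ℕ} (𝒟 : DPA mq (Letter (k + m * n) × Letter (k + m * n)))
           → Recognises 𝒟 (matrixPΞ ξ φ)
           → Game.VerifierWinsFromAllInit (extTS m 𝒯) 𝒟
theorem5 𝒯 𝒜 φ hφ hM ξ hξ 𝒟 hD x x-init =
  FlagStrategyWins.flagStrategy-wins 𝒯 𝒜 {φ} hφ hM {ξ} hξ 𝒟 hD x x-init
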